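{- For the complete split graph $S(n,m)$ with $n \ge 2$ fixed, \[\lim_{m\to\infty}\overline{C}(S(n,m)) = 1 \quad\text{and}\quad \lim_{m\to\infty} T(S(n,m)) = 0,\] and, with $k$ ranging over positive integers, \[\lim_{k\to\infty}\lim_{n\to\infty}\overline{C}(S(n,kn)) = 1 \quad\text{and}\quad \lim_{k\to\infty}\lim_{n\to\infty} T(S(n,kn)) = 0.\]
   Context: The complete split graph $S(n,m) = K_{n+m}-K_m$ consists of a clique on $n$ vertices and an independent set of $m$ vertices, with every clique vertex adjacent to all other vertices. For a graph on vertices $1,\dots,N$ with degrees $d_i$, let $t_i$ be the number of triangles containing vertex $i$; the Watts–Strogatz clustering coefficient of $i$ is $C_i = \frac{2t_i}{d_i(d_i-1)}$, the average clustering coefficient is $\overline{C} = \frac1N\sum_{i=1}^N C_i$, and the transitivity is $T = \frac{3\cdot(\text{number of triangles})}{\sum_{i=1}^N\binom{d_i}{2}}$. -}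

module Defs where

open import Data.Bool using (Bool; true; false; if_then_else_; _∧_; _∨_; not)
open import Data.Nat as Nat using (ℕ; zero; suc; _≥_; _<ᵇ_)
open import Data.Nat.Combinatorics using (_C_)
open import Data.Fin using (Fin; toℕ) renaming (zero to fzero; suc to fsuc)
open import Data.Fin.Properties using (_≟_)
open import Data.Integer using (+_)
open import Data.Rational using (ℚ; 0ℚ; _/_; _+_; _-_; _*_; ∣_∣; _≤_; _<_)
open import Data.Product using (Σ; _×_)
open import Relation.Nullary.Decidable using (⌊_⌋)

-- A finite simple graph on vertex set Fin N, given by a symmetric,
-- irreflexive Boolean adjacency relation.
record Graph : Set where
  field
    N     : ℕ
    adj   : Fin N → Fin N → Bool
open Graph public

count : ∀ {N} → (Fin N → Bool) → ℕ
count {zero}  f = 0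
count {suc N} f = (if f fzero then 1 else 0) Nat.+ count (λ i → f (fsuc i))

sumℕ : ∀ {N} → (Fin N → ℕ) → ℕ
sumℕ {zero}  f = 0
sumℕ {suc N} f = f fzero Nat.+ sumℕ (λ i → f (fsuc i))

sumℚ : ∀ {N} → (Fin N → ℚ) → ℚ
sumℚ {zero}  f = 0ℚ
sumℚ {suc N} f = f fzero + sumℚ (λ i → f (fsuc i))

-- a / b as a rational, with the convention x / 0 = 0
ratio : ℕ → ℕ → ℚ
ratio a zero    = 0ℚ
ratio a (suc b) = (+ a) / suc b

_<F_ : ∀ {N} → Fin N → Fin N → Bool
i <F j = toℕ i <ᵇ toℕ j

module _ (G : Graph) where
  private
    A = adj G

  degree : Fin (N G) → ℕ
  degree i = count (λ j → A i j)

  trianglesAt : Fin (N G) → ℕ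
  trianglesAt i = sumℕ (λ j → count (λ k → (j <F k) ∧ A i j ∧ A i k ∧ A j k))


  triangles : ℕ
  triangles = sumℕ (λ i → sumℕ (λ j → count (λ k →
                (i <F j) ∧ (j <F k) ∧ A i j ∧ A i k ∧ A j k)))

  -- Watts–Strogatz local clustering coefficient C_i = 2 t_i / (d_i (d_i - 1))
  -- (convention: C_i = 0 when d_i < 2)
  localClustering : Fin (N G) → ℚ
  localClustering i = ratio (2 Nat.* trianglesAt i) (degree i Nat.* (degree i Nat.∸ 1))

  avgClustering : ℚ
  avgClustering = sumℚ localClustering * ratio 1 (N G)

  transitivity : ℚ
  transitivity = ratio (3 Nat.* triangles) (sumℕ (λ i → degree i C 2))

-- The complete split graph S(n,m) = K_{n+m} - K_m : vertices 0..n-1 form a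
-- clique, vertices n..n+m-1 an independent set, every clique vertex is
-- adjacent to every other vertex.
splitGraph : ℕ → ℕ → Graph
splitGraph n m = record
  { N   = n Nat.+ m
  ; adj = λ i j → not ⌊ i ≟ j ⌋ ∧ ((toℕ i <ᵇ n) ∨ (toℕ j <ᵇ n))
  }

ConvergesTo : (ℕ → ℚ) → ℚ → Set
ConvergesTo a L = ∀ (ε : ℚ) → 0ℚ < ε → Σ ℕ λ M → ∀ m → m ≥ M → ∣ a m - L ∣ ≤ ε

-- Vertex 0 of S(n + 1, m) is adjacent to every other vertex and deleting it leaves S(n, m), while S(0, m)
-- has no edges.  Peeling off these apex vertices one at a time gives, via Pascal's rule, the degrees and
-- triangle counts in binomial form: a clique vertex of S(p + 1, m) has degree p + m and lies in
-- C(p,2) + pm triangles, an independent vertex of S(n, m) has degree n and lies in C(n,2) triangles, and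
-- S(n, m) has C(n,3) + C(n,2) m triangles.  So independent vertices have clustering 1, and for n = 2 + v
-- both the average clustering and the transitivity are explicit quotients p/q of polynomials.  Each limit
-- then follows from |p/q − a/b| = |pb − aq|/(qb) and a bound  index · |pb − aq| ≤ c · qb.
module Submission where

open import Defs
open import Data.Nat using (ℕ; _≤_; _*_)
open import Data.Rational using (ℚ; mkℚ; 0ℚ; 1ℚ)
open import Data.Product using (Σ; _×_; _,_)

open import Function using (_∘_)
open import Data.Bool using (Bool; true; false; if_then_else_; _∧_; _∨_; not)
open import Data.Bool.Properties using (∧-zeroʳ; ∧-identityʳ; ∨-zeroʳ)
open import Data.Nat using (zero; suc; _+_; _∸_; _<_; _<ᵇ_; z≤n; s≤s; z<s; ∣_-_∣)
open import Data.Nat.Properties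
  using ( 0<1+n; n≤1+n; ≤-refl; ≤-reflexive; ≤-trans; m≤m+n; m≤n+m
        ; m+n≤o⇒m≤o∸n; m+n≤o⇒n≤o; m+[n∸m]≡n
        ; +-assoc; +-mono-≤; *-comm; *-identityˡ; *-identityʳ; *-zeroʳ; *-distribˡ-+
        ; *-mono-<; *-mono-≤; *-monoˡ-≤; *-monoʳ-≤; *-cancelˡ-≤
        ; ∣-∣-comm; ∣-∣-identityʳ; ∣-∣-triangle; ∣m-m+n∣≡n; module ≤-Reasoning )
open import Data.Nat.Combinatorics using (_C_; nC1≡n; nCk+nC[k+1]≡[n+1]C[k+1])
open import Data.Nat.Tactic.RingSolver using (solve-∀)
open import Data.Fin using (Fin; toℕ; _↑ˡ_; _↑ʳ_) renaming (zero to fzero; suc to fsuc)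
open import Data.Fin.Properties using (_≟_)
open import Data.Integer as ℤ using (_⊖_)
import Data.Integer.Properties as ℤ
import Data.Rational as ℚ
import Data.Rational.Properties as ℚ
open import Data.Rational.Unnormalised as ℚᵘ using (mkℚᵘ; *≡*; *≤*)
import Data.Rational.Unnormalised.Properties as ℚᵘ
open import Relation.Nullary.Decidable using (⌊⌋-map′)
open import Relation.Binary.PropositionalEquality

count-cong : ∀ {N} {f g : Fin N → Bool} → (∀ i → f i ≡ g i) → count f ≡ count g
count-cong {zero}  f≗g = refl
count-cong {suc N} f≗g =
  cong₂ (λ b r → (if b then 1 else 0) + r) (f≗g fzero) (count-cong (f≗g ∘ fsuc))

count-false : ∀ {N} {f : Fin N → Bool} → (∀ i → f i ≡ false) → count f ≡ 0
count-false {zero}  f≗false = refl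
count-false {suc N} f≗false =
  cong₂ (λ b r → (if b then 1 else 0) + r) (f≗false fzero) (count-false (f≗false ∘ fsuc))

count-true : ∀ N → count {N} (λ _ → true) ≡ N
count-true zero    = refl
count-true (suc N) = cong suc (count-true N)

sumℕ-cong : ∀ {N} {f g : Fin N → ℕ} → (∀ i → f i ≡ g i) → sumℕ f ≡ sumℕ g
sumℕ-cong {zero}  f≗g = refl
sumℕ-cong {suc N} f≗g = cong₂ _+_ (f≗g fzero) (sumℕ-cong (f≗g ∘ fsuc))

sumℕ-zero : ∀ {N} {f : Fin N → ℕ} → (∀ i → f i ≡ 0) → sumℕ f ≡ 0
sumℕ-zero {zero}  f≗0 = refl
sumℕ-zero {suc N} f≗0 = cong₂ _+_ (f≗0 fzero) (sumℕ-zero (f≗0 ∘ fsuc))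

sumℕ-const : ∀ N c → sumℕ {N} (λ _ → c) ≡ N * c
sumℕ-const zero    c = refl
sumℕ-const (suc N) c = cong (c +_) (sumℕ-const N c)

sumℕ-↑ : ∀ n {m} (f : Fin (n + m) → ℕ) → sumℕ f ≡ sumℕ (f ∘ (_↑ˡ m)) + sumℕ (f ∘ (n ↑ʳ_))
sumℕ-↑ zero    f = refl
sumℕ-↑ (suc n) f = trans (cong (f fzero +_) (sumℕ-↑ n (f ∘ fsuc))) (sym (+-assoc (f fzero) _ _))

sumℚ-↑ : ∀ n {m} (f : Fin (n + m) → ℚ) → sumℚ f ≡ sumℚ (f ∘ (_↑ˡ m)) ℚ.+ sumℚ (f ∘ (n ↑ʳ_))
sumℚ-↑ zero    f = sym (ℚ.+-identityˡ _)
sumℚ-↑ (suc n) f = trans (cong (f fzero ℚ.+_) (sumℚ-↑ n (f ∘ fsuc))) (sym (ℚ.+-assoc (f fzero) _ _))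

sumℚ-cong : ∀ {N} {f g : Fin N → ℚ} → (∀ i → f i ≡ g i) → sumℚ f ≡ sumℚ g
sumℚ-cong {zero}  f≗g = refl
sumℚ-cong {suc N} f≗g = cong₂ ℚ._+_ (f≗g fzero) (sumℚ-cong (f≗g ∘ fsuc))

-- Graph invariants, edgeless graphs and cones

graphOf : ∀ {N} → (Fin N → Fin N → Bool) → Graph
graphOf {N} A = record { N = N ; adj = A }

edges : Graph → ℕ
edges G = sumℕ (λ j → count (λ k → (j <F k) ∧ adj G j k))

module _ {N} {A B : Fin N → Fin N → Bool} (A≗B : ∀ i j → A i j ≡ B i j) where

  degree-cong : ∀ i → degree (graphOf A) i ≡ degree (graphOf B) i
  degree-cong i = count-cong (A≗B i)

  edges-cong : edges (graphOf A) ≡ edges (graphOf B)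
  edges-cong = sumℕ-cong λ j → count-cong λ k → cong ((j <F k) ∧_) (A≗B j k)

  trianglesAt-cong : ∀ i → trianglesAt (graphOf A) i ≡ trianglesAt (graphOf B) i
  trianglesAt-cong i = sumℕ-cong λ j → count-cong λ k →
    cong ((j <F k) ∧_) (cong₂ _∧_ (A≗B i j) (cong₂ _∧_ (A≗B i k) (A≗B j k)))

  triangles-cong : triangles (graphOf A) ≡ triangles (graphOf B)
  triangles-cong = sumℕ-cong λ i → sumℕ-cong λ j → count-cong λ k →
    cong (λ b → (i <F j) ∧ (j <F k) ∧ b) (cong₂ _∧_ (A≗B i j) (cong₂ _∧_ (A≗B i k) (A≗B j k)))

module _ (G : Graph) (no-edge : ∀ i j → adj G i j ≡ false) where

  degree-edgeless : ∀ i → degree G i ≡ 0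
  degree-edgeless i = count-false (no-edge i)

  edges-edgeless : edges G ≡ 0
  edges-edgeless = sumℕ-zero λ j → count-false λ k →
    trans (cong ((j <F k) ∧_) (no-edge j k)) (∧-zeroʳ _)

  trianglesAt-edgeless : ∀ i → trianglesAt G i ≡ 0
  trianglesAt-edgeless i = sumℕ-zero λ j → count-false λ k →
    trans (cong (λ b → (j <F k) ∧ b ∧ adj G i k ∧ adj G j k) (no-edge i j)) (∧-zeroʳ _)

  triangles-edgeless : triangles G ≡ 0
  triangles-edgeless = sumℕ-zero λ i → sumℕ-zero λ j → count-false λ k →
    trans (cong (λ b → (i <F j) ∧ (j <F k) ∧ b ∧ adj G i k ∧ adj G j k) (no-edge i j))
          (trans (cong ((i <F j) ∧_) (∧-zeroʳ _)) (∧-zeroʳ _))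

coneAdj : ∀ {N} → (Fin N → Fin N → Bool) → Fin (suc N) → Fin (suc N) → Bool
coneAdj A fzero    fzero    = false
coneAdj A fzero    (fsuc _) = true
coneAdj A (fsuc _) fzero    = true
coneAdj A (fsuc i) (fsuc j) = A i j

cone : Graph → Graph
cone G = record { N = suc (N G) ; adj = coneAdj (adj G) }

module _ (G : Graph) where

  degree-cone-apex : degree (cone G) fzero ≡ N G
  degree-cone-apex = count-true (N G)

  degree-cone-suc : ∀ i → degree (cone G) (fsuc i) ≡ suc (degree G i)
  degree-cone-suc i = refl

  edges-cone : edges (cone G) ≡ N G + edges G
  edges-cone = cong (_+ edges G) (count-true (N G))

  trianglesAt-cone-apex : trianglesAt (cone G) fzero ≡ edges G
  trianglesAt-cone-apex = cong (_+ edges G) (count-false {suc (N G)} λ _ → refl)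

  trianglesAt-cone-suc : ∀ i → trianglesAt (cone G) (fsuc i) ≡ degree G i + trianglesAt G i
  trianglesAt-cone-suc i = cong (_+ trianglesAt G i) (count-cong λ k → ∧-identityʳ (adj G i k))

  triangles-cone : triangles (cone G) ≡ edges G + triangles G
  triangles-cone = cong₂ _+_ (cong (_+ edges G) (count-false {suc (N G)} λ _ → refl))
    (sumℕ-cong λ i → cong₂ _+_ (count-false {suc (N G)} λ _ → refl) (sumℕ-cong λ j →
      cong (λ b → (if b then 1 else 0)
                  + count (λ k → (i <F j) ∧ (j <F k) ∧ adj G i j ∧ adj G i k ∧ adj G j k))
           (∧-zeroʳ (i <F j))))

-- Degrees and triangles of the complete split graph

[1+n]C2≡n+nC2 : ∀ n → suc n C 2 ≡ n + n C 2
[1+n]C2≡n+nC2 n = trans (sym (nCk+nC[k+1]≡[n+1]C[k+1] n 1)) (cong (_+ n C 2) (nC1≡n n))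

2*[1+n]C2≡[1+n]*n : ∀ n → 2 * (suc n C 2) ≡ suc n * n
2*[1+n]C2≡[1+n]*n zero    = refl
2*[1+n]C2≡[1+n]*n (suc n) = begin
  2 * (suc (suc n) C 2)       ≡⟨ cong (2 *_) ([1+n]C2≡n+nC2 (suc n)) ⟩
  2 * (suc n + suc n C 2)     ≡⟨ *-distribˡ-+ 2 (suc n) (suc n C 2) ⟩
  2 * suc n + 2 * (suc n C 2) ≡⟨ cong (2 * suc n +_) (2*[1+n]C2≡[1+n]*n n) ⟩
  2 * suc n + suc n * n       ≡⟨ rearrange n ⟩
  suc (suc n) * suc n         ∎
  where
  open ≡-Reasoning
  rearrange : ∀ n → 2 * suc n + suc n * n ≡ suc (suc n) * suc n
  rearrange = solve-∀

6*[2+n]C3≡[2+n]*[1+n]*n : ∀ n → 6 * (suc (suc n) C 3) ≡ suc (suc n) * suc n * n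
6*[2+n]C3≡[2+n]*[1+n]*n zero    = refl
6*[2+n]C3≡[2+n]*[1+n]*n (suc n) = begin
  6 * ((3 + n) C 3)                                    ≡⟨ cong (6 *_) (nCk+nC[k+1]≡[n+1]C[k+1] (2 + n) 2) ⟨
  6 * ((2 + n) C 2 + (2 + n) C 3)                    ≡⟨ rearrange₁ ((2 + n) C 2) ((2 + n) C 3) ⟩
  3 * (2 * ((2 + n) C 2)) + 6 * ((2 + n) C 3)
    ≡⟨ cong₂ (λ c₂ c₃ → 3 * c₂ + c₃) (2*[1+n]C2≡[1+n]*n (suc n)) (6*[2+n]C3≡[2+n]*[1+n]*n n) ⟩
  3 * ((2 + n) * (1 + n)) + (2 + n) * (1 + n) * n    ≡⟨ rearrange₂ n ⟩
  (3 + n) * (2 + n) * (1 + n)                        ∎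
  where
  open ≡-Reasoning
  rearrange₁ : ∀ a b → 6 * (a + b) ≡ 3 * (2 * a) + 6 * b
  rearrange₁ = solve-∀
  rearrange₂ : ∀ n → 3 * ((2 + n) * (1 + n)) + (2 + n) * (1 + n) * n ≡ (3 + n) * (2 + n) * (1 + n)
  rearrange₂ = solve-∀

splitGraph-suc : ∀ n m i j → adj (splitGraph (suc n) m) i j ≡ adj (cone (splitGraph n m)) i j
splitGraph-suc n m fzero    fzero    = refl
splitGraph-suc n m fzero    (fsuc j) = refl
splitGraph-suc n m (fsuc i) fzero    = ∨-zeroʳ (toℕ i <ᵇ n)
splitGraph-suc n m (fsuc i) (fsuc j) =
  cong (λ b → not b ∧ ((toℕ i <ᵇ n) ∨ (toℕ j <ᵇ n))) (⌊⌋-map′ _ _ (i ≟ j))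

splitGraph-zero : ∀ m i j → adj (splitGraph 0 m) i j ≡ false
splitGraph-zero m i j = ∧-zeroʳ (not _)

splitEdges : ℕ → ℕ → ℕ
splitEdges n m = n C 2 + n * m

splitTriangles : ℕ → ℕ → ℕ
splitTriangles n m = n C 3 + (n C 2) * m

splitEdges-suc : ∀ n m → n + m + splitEdges n m ≡ splitEdges (suc n) m
splitEdges-suc n m = trans (rearrange n m (n C 2)) (cong (λ c → c + suc n * m) (sym ([1+n]C2≡n+nC2 n)))
  where
  rearrange : ∀ n m c → n + m + (c + n * m) ≡ n + c + suc n * m
  rearrange = solve-∀

splitTriangles-suc : ∀ n m → splitEdges n m + splitTriangles n m ≡ splitTriangles (suc n) m
splitTriangles-suc n m = trans (rearrange n m (n C 2) (n C 3))
  (cong₂ (λ c₃ c₂ → c₃ + c₂ * m) (nCk+nC[k+1]≡[n+1]C[k+1] n 2) (sym ([1+n]C2≡n+nC2 n)))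
  where
  rearrange : ∀ n m c₂ c₃ → c₂ + n * m + (c₃ + c₂ * m) ≡ c₂ + c₃ + (n + c₂) * m
  rearrange = solve-∀

degree-clique : ∀ p m (i : Fin (suc p)) → degree (splitGraph (suc p) m) (i ↑ˡ m) ≡ p + m
degree-clique p       m fzero    =
  trans (degree-cong (splitGraph-suc p m) fzero) (degree-cone-apex (splitGraph p m))
degree-clique (suc p) m (fsuc i) =
  trans (degree-cong (splitGraph-suc (suc p) m) (fsuc (i ↑ˡ m)))
        (trans (degree-cone-suc (splitGraph (suc p) m) (i ↑ˡ m)) (cong suc (degree-clique p m i)))

degree-independent : ∀ n m (j : Fin m) → degree (splitGraph n m) (n ↑ʳ j) ≡ n
degree-independent zero    m j = degree-edgeless (splitGraph 0 m) (splitGraph-zero m) j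
degree-independent (suc n) m j =
  trans (degree-cong (splitGraph-suc n m) (fsuc (n ↑ʳ j)))
        (trans (degree-cone-suc (splitGraph n m) (n ↑ʳ j)) (cong suc (degree-independent n m j)))

edges-split : ∀ n m → edges (splitGraph n m) ≡ splitEdges n m
edges-split zero    m = edges-edgeless (splitGraph 0 m) (splitGraph-zero m)
edges-split (suc n) m = begin
  edges (splitGraph (suc n) m)     ≡⟨ edges-cong (splitGraph-suc n m) ⟩
  edges (cone (splitGraph n m))    ≡⟨ edges-cone (splitGraph n m) ⟩
  n + m + edges (splitGraph n m)   ≡⟨ cong (n + m +_) (edges-split n m) ⟩
  n + m + splitEdges n m           ≡⟨ splitEdges-suc n m ⟩
  splitEdges (suc n) m             ∎
  where open ≡-Reasoning

trianglesAt-clique : ∀ p m (i : Fin (suc p)) →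
  trianglesAt (splitGraph (suc p) m) (i ↑ˡ m) ≡ splitEdges p m
trianglesAt-clique p m fzero = begin
  trianglesAt (splitGraph (suc p) m) fzero  ≡⟨ trianglesAt-cong (splitGraph-suc p m) fzero ⟩
  trianglesAt (cone (splitGraph p m)) fzero ≡⟨ trianglesAt-cone-apex (splitGraph p m) ⟩
  edges (splitGraph p m)                    ≡⟨ edges-split p m ⟩
  splitEdges p m                            ∎
  where open ≡-Reasoning
trianglesAt-clique (suc p) m (fsuc i) = begin
  trianglesAt (splitGraph (suc (suc p)) m) (fsuc (i ↑ˡ m))
    ≡⟨ trianglesAt-cong (splitGraph-suc (suc p) m) (fsuc (i ↑ˡ m)) ⟩
  trianglesAt (cone (splitGraph (suc p) m)) (fsuc (i ↑ˡ m))
    ≡⟨ trianglesAt-cone-suc (splitGraph (suc p) m) (i ↑ˡ m) ⟩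
  degree (splitGraph (suc p) m) (i ↑ˡ m) + trianglesAt (splitGraph (suc p) m) (i ↑ˡ m)
    ≡⟨ cong₂ _+_ (degree-clique p m i) (trianglesAt-clique p m i) ⟩
  p + m + splitEdges p m
    ≡⟨ splitEdges-suc p m ⟩
  splitEdges (suc p) m ∎
  where open ≡-Reasoning

trianglesAt-independent : ∀ n m (j : Fin m) → trianglesAt (splitGraph n m) (n ↑ʳ j) ≡ n C 2
trianglesAt-independent zero    m j = trianglesAt-edgeless (splitGraph 0 m) (splitGraph-zero m) j
trianglesAt-independent (suc n) m j = begin
  trianglesAt (splitGraph (suc n) m) (fsuc (n ↑ʳ j))
    ≡⟨ trianglesAt-cong (splitGraph-suc n m) (fsuc (n ↑ʳ j)) ⟩
  trianglesAt (cone (splitGraph n m)) (fsuc (n ↑ʳ j))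
    ≡⟨ trianglesAt-cone-suc (splitGraph n m) (n ↑ʳ j) ⟩
  degree (splitGraph n m) (n ↑ʳ j) + trianglesAt (splitGraph n m) (n ↑ʳ j)
    ≡⟨ cong₂ _+_ (degree-independent n m j) (trianglesAt-independent n m j) ⟩
  n + n C 2
    ≡⟨ [1+n]C2≡n+nC2 n ⟨
  suc n C 2 ∎
  where open ≡-Reasoning

triangles-split : ∀ n m → triangles (splitGraph n m) ≡ splitTriangles n m
triangles-split zero    m = triangles-edgeless (splitGraph 0 m) (splitGraph-zero m)
triangles-split (suc n) m = begin
  triangles (splitGraph (suc n) m)                  ≡⟨ triangles-cong (splitGraph-suc n m) ⟩
  triangles (cone (splitGraph n m))                 ≡⟨ triangles-cone (splitGraph n m) ⟩
  edges (splitGraph n m) + triangles (splitGraph n m)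
    ≡⟨ cong₂ _+_ (edges-split n m) (triangles-split n m) ⟩
  splitEdges n m + splitTriangles n m               ≡⟨ splitTriangles-suc n m ⟩
  splitTriangles (suc n) m                          ∎
  where open ≡-Reasoning

degreeC2-sum-split : ∀ p m →
  sumℕ (λ i → degree (splitGraph (suc p) m) i C 2) ≡ suc p * ((p + m) C 2) + m * (suc p C 2)
degreeC2-sum-split p m = begin
  sumℕ f                                                   ≡⟨ sumℕ-↑ (suc p) f ⟩
  sumℕ (f ∘ (_↑ˡ m)) + sumℕ (f ∘ (suc p ↑ʳ_))
    ≡⟨ cong₂ _+_ (sumℕ-cong λ i → cong (_C 2) (degree-clique p m i))
                 (sumℕ-cong λ j → cong (_C 2) (degree-independent (suc p) m j)) ⟩
  sumℕ {suc p} (λ _ → (p + m) C 2) + sumℕ {m} (λ _ → suc p C 2)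
    ≡⟨ cong₂ _+_ (sumℕ-const (suc p) _) (sumℕ-const m _) ⟩
  suc p * ((p + m) C 2) + m * (suc p C 2) ∎
  where
  open ≡-Reasoning
  f = λ i → degree (splitGraph (suc p) m) i C 2

fromℚᵘ-+ : ∀ p q → ℚ.fromℚᵘ p ℚ.+ ℚ.fromℚᵘ q ≡ ℚ.fromℚᵘ (p ℚᵘ.+ q)
fromℚᵘ-+ p q = ℚ.toℚᵘ-injective (begin
  ℚ.toℚᵘ (ℚ.fromℚᵘ p ℚ.+ ℚ.fromℚᵘ q)            ≈⟨ ℚ.toℚᵘ-homo-+ (ℚ.fromℚᵘ p) (ℚ.fromℚᵘ q) ⟩
  ℚ.toℚᵘ (ℚ.fromℚᵘ p) ℚᵘ.+ ℚ.toℚᵘ (ℚ.fromℚᵘ q) ≈⟨ ℚᵘ.+-cong (ℚ.toℚᵘ-fromℚᵘ p) (ℚ.toℚᵘ-fromℚᵘ q) ⟩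
  p ℚᵘ.+ q                                      ≈⟨ ℚ.toℚᵘ-fromℚᵘ (p ℚᵘ.+ q) ⟨
  ℚ.toℚᵘ (ℚ.fromℚᵘ (p ℚᵘ.+ q))                  ∎)
  where open ℚᵘ.≃-Reasoning

fromℚᵘ-* : ∀ p q → ℚ.fromℚᵘ p ℚ.* ℚ.fromℚᵘ q ≡ ℚ.fromℚᵘ (p ℚᵘ.* q)
fromℚᵘ-* p q = ℚ.toℚᵘ-injective (begin
  ℚ.toℚᵘ (ℚ.fromℚᵘ p ℚ.* ℚ.fromℚᵘ q)            ≈⟨ ℚ.toℚᵘ-homo-* (ℚ.fromℚᵘ p) (ℚ.fromℚᵘ q) ⟩
  ℚ.toℚᵘ (ℚ.fromℚᵘ p) ℚᵘ.* ℚ.toℚᵘ (ℚ.fromℚᵘ q) ≈⟨ ℚᵘ.*-cong (ℚ.toℚᵘ-fromℚᵘ p) (ℚ.toℚᵘ-fromℚᵘ q) ⟩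
  p ℚᵘ.* q                                      ≈⟨ ℚ.toℚᵘ-fromℚᵘ (p ℚᵘ.* q) ⟨
  ℚ.toℚᵘ (ℚ.fromℚᵘ (p ℚᵘ.* q))                  ∎)
  where open ℚᵘ.≃-Reasoning

∣m⊖n∣≡∣m-n∣ : ∀ m n → ℤ.∣ m ⊖ n ∣ ≡ ∣ m - n ∣
∣m⊖n∣≡∣m-n∣ zero    zero    = refl
∣m⊖n∣≡∣m-n∣ zero    (suc n) = refl
∣m⊖n∣≡∣m-n∣ (suc m) zero    = refl
∣m⊖n∣≡∣m-n∣ (suc m) (suc n) = trans (cong ℤ.∣_∣ (ℤ.[1+m]⊖[1+n]≡m⊖n m n)) (∣m⊖n∣≡∣m-n∣ m n)

ratio-cong : ∀ {a b c d} → 0 < b → 0 < d → a * d ≡ c * b → ratio a b ≡ ratio c d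
ratio-cong {a} {suc b} {c} {suc d} _ _ ad≡cb =
  ℚ.fromℚᵘ-cong {mkℚᵘ (ℤ.+ a) b} {mkℚᵘ (ℤ.+ c) d}
    (*≡* (trans (sym (ℤ.pos-* a (suc d))) (trans (cong ℤ.+_ ad≡cb) (ℤ.pos-* c (suc b)))))

-- No positivity of b is needed: when b = 0 both sides are the junk value ratio _ 0 = 0.
ratio-scale : ∀ k {a b} → 0 < k → ratio (k * a) (k * b) ≡ ratio a b
ratio-scale k {a} {zero}  0<k = cong (ratio (k * a)) (*-zeroʳ k)
ratio-scale k {a} {suc b} 0<k =
  ratio-cong {c = a} {d = suc b} (*-mono-< 0<k z<s) z<s (rearrange k a (suc b))
  where
  rearrange : ∀ k a b → k * a * b ≡ a * (k * b)
  rearrange = solve-∀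

ratio-self : ∀ {a} → 0 < a → ratio a a ≡ 1ℚ
ratio-self {a} 0<a = ratio-cong {c = 1} {d = 1} 0<a z<s (*-comm a 1)

ratio-+ : ∀ {a b c d} → 0 < b → 0 < d → ratio a b ℚ.+ ratio c d ≡ ratio (a * d + c * b) (b * d)
ratio-+ {a} {suc b} {c} {suc d} _ _ = trans (fromℚᵘ-+ (mkℚᵘ (ℤ.+ a) b) (mkℚᵘ (ℤ.+ c) d))
  (cong (λ z → ℚ.fromℚᵘ (mkℚᵘ z (d + b * suc d)))
        (cong₂ ℤ._+_ (sym (ℤ.pos-* a (suc d))) (sym (ℤ.pos-* c (suc b)))))

ratio-* : ∀ {a b c d} → 0 < b → 0 < d → ratio a b ℚ.* ratio c d ≡ ratio (a * c) (b * d)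
ratio-* {a} {suc b} {c} {suc d} _ _ = trans (fromℚᵘ-* (mkℚᵘ (ℤ.+ a) b) (mkℚᵘ (ℤ.+ c) d))
  (cong (λ z → ℚ.fromℚᵘ (mkℚᵘ z (d + b * suc d))) (sym (ℤ.pos-* a c)))

ratio-mono : ∀ {a b c d} → 0 < b → 0 < d → a * d ≤ c * b → ratio a b ℚ.≤ ratio c d
ratio-mono {a} {suc b} {c} {suc d} _ _ ad≤cb = ℚ.toℚᵘ-cancel-≤ (begin
  ℚ.toℚᵘ (ratio a (suc b)) ≃⟨ ℚ.toℚᵘ-fromℚᵘ (mkℚᵘ (ℤ.+ a) b) ⟩
  mkℚᵘ (ℤ.+ a) b
    ≤⟨ *≤* (subst₂ ℤ._≤_ (ℤ.pos-* a (suc d)) (ℤ.pos-* c (suc b)) (ℤ.+≤+ ad≤cb)) ⟩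
  mkℚᵘ (ℤ.+ c) d           ≃⟨ ℚ.toℚᵘ-fromℚᵘ (mkℚᵘ (ℤ.+ c) d) ⟨
  ℚ.toℚᵘ (ratio c (suc d)) ∎)
  where open ℚᵘ.≤-Reasoning

∣+m*+n-+a*+b∣ : ∀ m n a b → ℤ.∣ ℤ.+ m ℤ.* ℤ.+ n ℤ.+ ℤ.- (ℤ.+ a) ℤ.* ℤ.+ b ∣ ≡ ∣ m * n - a * b ∣
∣+m*+n-+a*+b∣ m n a b = begin
  ℤ.∣ ℤ.+ m ℤ.* ℤ.+ n ℤ.+ ℤ.- (ℤ.+ a) ℤ.* ℤ.+ b ∣
    ≡⟨ cong₂ (λ u w → ℤ.∣ u ℤ.+ w ∣) (sym (ℤ.pos-* m n))
             (trans (sym (ℤ.neg-distribˡ-* (ℤ.+ a) (ℤ.+ b))) (cong ℤ.-_ (sym (ℤ.pos-* a b)))) ⟩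
  ℤ.∣ ℤ.+ (m * n) ℤ.+ ℤ.- ℤ.+ (a * b) ∣ ≡⟨ cong ℤ.∣_∣ (ℤ.m-n≡m⊖n (m * n) (a * b)) ⟩
  ℤ.∣ (m * n) ⊖ (a * b) ∣               ≡⟨ ∣m⊖n∣≡∣m-n∣ (m * n) (a * b) ⟩
  ∣ m * n - a * b ∣                     ∎
  where open ≡-Reasoning

∣ratio-ratio∣ : ∀ {p q a b} → 0 < q → 0 < b →
  ℚ.∣ ratio p q ℚ.- ratio a b ∣ ≡ ratio ∣ p * b - a * q ∣ (q * b)
∣ratio-ratio∣ {p} {suc q} {a} {suc b} _ _ = ℚ.toℚᵘ-injective (begin
  ℚ.toℚᵘ ℚ.∣ x ℚ.- y ∣               ≈⟨ ℚ.toℚᵘ-homo-∣-∣ (x ℚ.- y) ⟩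
  ℚᵘ.∣ ℚ.toℚᵘ (x ℚ.- y) ∣            ≈⟨ ℚᵘ.∣-∣-cong (ℚ.toℚᵘ-homo-+ x (ℚ.- y)) ⟩
  ℚᵘ.∣ ℚ.toℚᵘ x ℚᵘ.+ ℚ.toℚᵘ (ℚ.- y) ∣
    ≈⟨ ℚᵘ.∣-∣-cong (ℚᵘ.+-cong (ℚ.toℚᵘ-fromℚᵘ x̂)
                              (ℚᵘ.≃-trans (ℚ.toℚᵘ-homo‿- y) (ℚᵘ.-‿cong (ℚ.toℚᵘ-fromℚᵘ ŷ)))) ⟩
  ℚᵘ.∣ x̂ ℚᵘ.- ŷ ∣
    ≡⟨ cong (λ z → mkℚᵘ (ℤ.+ z) (b + q * suc b)) (∣+m*+n-+a*+b∣ p (suc b) a (suc q)) ⟩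
  mkℚᵘ (ℤ.+ ∣ p * suc b - a * suc q ∣) (b + q * suc b)
    ≈⟨ ℚ.toℚᵘ-fromℚᵘ (mkℚᵘ (ℤ.+ ∣ p * suc b - a * suc q ∣) (b + q * suc b)) ⟨
  ℚ.toℚᵘ (ratio ∣ p * suc b - a * suc q ∣ (suc q * suc b)) ∎)
  where
  open ℚᵘ.≃-Reasoning
  x̂ = mkℚᵘ (ℤ.+ p) q
  ŷ = mkℚᵘ (ℤ.+ a) b
  x = ℚ.fromℚᵘ x̂
  y = ℚ.fromℚᵘ ŷ

sumℚ-const : ∀ N {a b} → 0 < b → sumℚ {N} (λ _ → ratio a b) ≡ ratio (N * a) b
sumℚ-const zero    {a} {suc b} _   = sym (ℚ.0/n≡0 (suc b))
sumℚ-const (suc N) {a} {b}     0<b = begin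
  ratio a b ℚ.+ sumℚ {N} (λ _ → ratio a b) ≡⟨ cong (ratio a b ℚ.+_) (sumℚ-const N 0<b) ⟩
  ratio a b ℚ.+ ratio (N * a) b           ≡⟨ ratio-+ 0<b 0<b ⟩
  ratio (a * b + N * a * b) (b * b)       ≡⟨ ratio-cong (*-mono-< 0<b 0<b) 0<b (rearrange a b N) ⟩
  ratio (suc N * a) b                     ∎
  where
  open ≡-Reasoning
  rearrange : ∀ a b N → (a * b + N * a * b) * b ≡ (a + N * a) * (b * b)
  rearrange = solve-∀

∣-∣-≤ : ∀ {x y X Y} → x + X ≡ y + Y → ∣ x - y ∣ ≤ X + Y
∣-∣-≤ {x} {y} {X} {Y} x+X≡y+Y = begin
  ∣ x - y ∣                     ≤⟨ ∣-∣-triangle x (x + X) y ⟩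
  ∣ x - x + X ∣ + ∣ x + X - y ∣
    ≡⟨ cong₂ _+_ (∣m-m+n∣≡n x X)
                 (trans (cong ∣_- y ∣ x+X≡y+Y) (trans (∣-∣-comm (y + Y) y) (∣m-m+n∣≡n y Y))) ⟩
  X + Y                         ∎
  where open ≤-Reasoning

reciprocal-below : ∀ ε → 0ℚ ℚ.< ε → Σ ℕ λ s → ratio 1 (suc s) ℚ.≤ ε
reciprocal-below ε@(mkℚ (ℤ.+ suc a) d _) _ =
  d , subst (ratio 1 (suc d) ℚ.≤_) (ℚ.fromℚᵘ-toℚᵘ ε)
            (ratio-mono {1} {suc d} {suc a} {suc d} z<s z<s (*-monoˡ-≤ (suc d) {1} {suc a} (s≤s z≤n)))
reciprocal-below (mkℚ (ℤ.+ zero) d _) (ℚ.*<* (ℤ.+<+ ()))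
reciprocal-below (mkℚ ℤ.-[1+ a ] d _) (ℚ.*<* ())

decay-bound : ∀ c s n {D E} → suc c * suc s ≤ n → n * D ≤ c * E → D * suc s ≤ E
decay-bound c s n {D} {E} M≤n nD≤CE = *-cancelˡ-≤ (suc c) (begin
  suc c * (D * suc s) ≡⟨ rearrange (suc c) D (suc s) ⟩
  D * (suc c * suc s) ≤⟨ *-monoʳ-≤ D M≤n ⟩
  D * n               ≡⟨ *-comm D n ⟩
  n * D               ≤⟨ nD≤CE ⟩
  c * E               ≤⟨ *-monoˡ-≤ E (n≤1+n c) ⟩
  suc c * E           ∎)
  where
  open ≤-Reasoning
  rearrange : ∀ c d s → c * (d * s) ≡ d * (c * s)
  rearrange = solve-∀

ratio-convergesTo : ∀ {p q : ℕ → ℕ} {a b} c → 0 < b → (∀ n → 0 < q n) →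
  (∀ n → n * ∣ p n * b - a * q n ∣ ≤ c * (q n * b)) →
  ConvergesTo (λ n → ratio (p n) (q n)) (ratio a b)
ratio-convergesTo {p} {q} {a} {b} c 0<b 0<q decay ε 0<ε with reciprocal-below ε 0<ε
... | s , 1/s≤ε = suc c * suc s , λ n M≤n → begin
  ℚ.∣ ratio (p n) (q n) ℚ.- ratio a b ∣  ≡⟨ ∣ratio-ratio∣ (0<q n) 0<b ⟩
  ratio ∣ p n * b - a * q n ∣ (q n * b) ≤⟨ ratio-mono {c = 1} {d = suc s} (*-mono-< (0<q n) 0<b) z<s
                                              (≤-trans (decay-bound c s n M≤n (decay n))
                                                       (≤-reflexive (sym (*-identityˡ _)))) ⟩
  ratio 1 (suc s)                        ≤⟨ 1/s≤ε ⟩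
  ε                                      ∎
  where open ℚ.≤-Reasoning

convergesTo-shift : ∀ k {f : ℕ → ℚ} {L} → ConvergesTo (λ n → f (k + n)) L → ConvergesTo f L
convergesTo-shift k {f} {L} f[k+_]→L ε 0<ε with f[k+_]→L ε 0<ε
... | M , close = M + k , λ n M+k≤n →
  subst (λ i → ℚ.∣ f i ℚ.- L ∣ ℚ.≤ ε) (m+[n∸m]≡n (m+n≤o⇒n≤o M M+k≤n))
        (close (n ∸ k) (m+n≤o⇒m≤o∸n M M+k≤n))

convergesTo-cong : ∀ {f g : ℕ → ℚ} {L} → (∀ n → f n ≡ g n) → ConvergesTo g L → ConvergesTo f L
convergesTo-cong {f} {g} {L} f≗g g→L ε 0<ε with g→L ε 0<ε
... | M , close = M , λ n M≤n → subst (λ x → ℚ.∣ x ℚ.- L ∣ ℚ.≤ ε) (sym (f≗g n)) (close n M≤n)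

-- Clustering and transitivity of S(2 + v, m)

-- In S(2 + v, m) a clique vertex has 2tᵢ = cliqueNum v m and dᵢ(dᵢ - 1) = cliqueDen v m.
cliqueNum cliqueDen : ℕ → ℕ → ℕ
cliqueNum v m = suc v * v + 2 * suc v * m
cliqueDen v m = suc (v + m) * (v + m)

cliqueDen-pos : ∀ {v m} → 0 < v + m → 0 < cliqueDen v m
cliqueDen-pos {v} {m} 0<v+m = *-mono-< (0<1+n {v + m}) 0<v+m

localClustering-clique : ∀ v m (i : Fin (2 + v)) →
  localClustering (splitGraph (2 + v) m) (i ↑ˡ m) ≡ ratio (cliqueNum v m) (cliqueDen v m)
localClustering-clique v m i = begin
  localClustering (splitGraph (2 + v) m) (i ↑ˡ m)
    ≡⟨ cong₂ (λ t d → ratio (2 * t) (d * (d ∸ 1)))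
             (trianglesAt-clique (suc v) m i) (degree-clique (suc v) m i) ⟩
  ratio (2 * (suc v C 2 + suc v * m)) (cliqueDen v m)
    ≡⟨ cong (λ t → ratio t (cliqueDen v m)) twice-t ⟩
  ratio (cliqueNum v m) (cliqueDen v m) ∎
  where
  open ≡-Reasoning
  rearrange : ∀ c v m → 2 * (c + suc v * m) ≡ 2 * c + 2 * suc v * m
  rearrange = solve-∀
  twice-t : 2 * (suc v C 2 + suc v * m) ≡ cliqueNum v m
  twice-t = trans (rearrange (suc v C 2) v m) (cong (_+ 2 * suc v * m) (2*[1+n]C2≡[1+n]*n v))

localClustering-independent : ∀ v m (j : Fin m) →
  localClustering (splitGraph (2 + v) m) ((2 + v) ↑ʳ j) ≡ 1ℚ
localClustering-independent v m j = begin
  localClustering (splitGraph (2 + v) m) ((2 + v) ↑ʳ j)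
    ≡⟨ cong₂ (λ t d → ratio (2 * t) (d * (d ∸ 1)))
             (trianglesAt-independent (2 + v) m j) (degree-independent (2 + v) m j) ⟩
  ratio (2 * ((2 + v) C 2)) ((2 + v) * suc v)
    ≡⟨ cong (λ t → ratio t ((2 + v) * suc v)) (2*[1+n]C2≡[1+n]*n (suc v)) ⟩
  ratio ((2 + v) * suc v) ((2 + v) * suc v)  ≡⟨ ratio-self {(2 + v) * suc v} z<s ⟩
  1ℚ                                         ∎
  where open ≡-Reasoning

avgClustering-split : ∀ v m → 0 < v + m →
  avgClustering (splitGraph (2 + v) m)
    ≡ ratio ((2 + v) * cliqueNum v m + m * cliqueDen v m) ((2 + v + m) * cliqueDen v m)
avgClustering-split v m 0<v+m = begin
  sumℚ C ℚ.* ratio 1 (n + m)                                   ≡⟨ cong (ℚ._* ratio 1 (n + m)) sum-C ⟩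
  ratio (n * c * 1 + m * 1 * e) (e * 1) ℚ.* ratio 1 (n + m)     ≡⟨ ratio-* {c = 1} {d = n + m} 0<e*1 z<s ⟩
  ratio ((n * c * 1 + m * 1 * e) * 1) (e * 1 * (n + m))
    ≡⟨ ratio-cong {c = n * c + m * e} {d = (n + m) * e} (*-mono-< 0<e*1 (0<1+n {suc (v + m)}))
                  (*-mono-< (0<1+n {suc (v + m)}) 0<e) (rearrange n m c e) ⟩
  ratio (n * c + m * e) ((n + m) * e)                           ∎
  where
  open ≡-Reasoning
  n = 2 + v
  c = cliqueNum v m
  e = cliqueDen v m
  C = localClustering (splitGraph n m)
  0<e : 0 < e
  0<e = cliqueDen-pos {v} {m} 0<v+m
  0<e*1 : 0 < e * 1
  0<e*1 = *-mono-< 0<e z<s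
  rearrange : ∀ n m c e →
    (n * c * 1 + m * 1 * e) * 1 * ((n + m) * e) ≡ (n * c + m * e) * (e * 1 * (n + m))
  rearrange = solve-∀
  sum-C : sumℚ C ≡ ratio (n * c * 1 + m * 1 * e) (e * 1)
  sum-C = begin
    sumℚ C                                                     ≡⟨ sumℚ-↑ n C ⟩
    sumℚ (C ∘ (_↑ˡ m)) ℚ.+ sumℚ (C ∘ (n ↑ʳ_))
      ≡⟨ cong₂ ℚ._+_ (sumℚ-cong (localClustering-clique v m))
                     (sumℚ-cong (localClustering-independent v m)) ⟩
    sumℚ {n} (λ _ → ratio c e) ℚ.+ sumℚ {m} (λ _ → ratio 1 1)
      ≡⟨ cong₂ ℚ._+_ (sumℚ-const n 0<e) (sumℚ-const m z<s) ⟩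
    ratio (n * c) e ℚ.+ ratio (m * 1) 1                        ≡⟨ ratio-+ {c = m * 1} {d = 1} 0<e z<s ⟩
    ratio (n * c * 1 + m * 1 * e) (e * 1)                      ∎

transitivity-split : ∀ v m →
  transitivity (splitGraph (2 + v) m) ≡ ratio (suc v * (v + 3 * m)) (cliqueDen v m + m * suc v)
transitivity-split v m = begin
  ratio (3 * triangles (splitGraph n m)) (sumℕ (λ i → degree (splitGraph n m) i C 2))
    ≡⟨ cong₂ (λ t s → ratio (3 * t) s) (triangles-split n m) (degreeC2-sum-split (suc v) m) ⟩
  ratio (3 * splitTriangles n m) (n * ((suc v + m) C 2) + m * (n C 2))
    ≡⟨ ratio-scale 2 {3 * splitTriangles n m} {n * ((suc v + m) C 2) + m * (n C 2)} z<s ⟨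
  ratio (2 * (3 * splitTriangles n m)) (2 * (n * ((suc v + m) C 2) + m * (n C 2)))
    ≡⟨ cong₂ ratio twice-numerator twice-denominator ⟩
  ratio (n * (suc v * (v + 3 * m))) (n * (cliqueDen v m + m * suc v))
    ≡⟨ ratio-scale n {suc v * (v + 3 * m)} {cliqueDen v m + m * suc v} z<s ⟩
  ratio (suc v * (v + 3 * m)) (cliqueDen v m + m * suc v) ∎
  where
  open ≡-Reasoning
  n = 2 + v
  twice-numerator : 2 * (3 * splitTriangles n m) ≡ n * (suc v * (v + 3 * m))
  twice-numerator = begin
    2 * (3 * (n C 3 + (n C 2) * m))          ≡⟨ rearrange₁ (n C 3) (n C 2) m ⟩
    6 * (n C 3) + 3 * (2 * (n C 2)) * m
      ≡⟨ cong₂ (λ c₃ c₂ → c₃ + 3 * c₂ * m) (6*[2+n]C3≡[2+n]*[1+n]*n v) (2*[1+n]C2≡[1+n]*n (suc v)) ⟩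
    n * suc v * v + 3 * (n * suc v) * m      ≡⟨ rearrange₂ v m ⟩
    n * (suc v * (v + 3 * m))                ∎
    where
    rearrange₁ : ∀ c₃ c₂ m → 2 * (3 * (c₃ + c₂ * m)) ≡ 6 * c₃ + 3 * (2 * c₂) * m
    rearrange₁ = solve-∀
    rearrange₂ : ∀ v m →
      (2 + v) * suc v * v + 3 * ((2 + v) * suc v) * m ≡ (2 + v) * (suc v * (v + 3 * m))
    rearrange₂ = solve-∀
  twice-denominator : 2 * (n * ((suc v + m) C 2) + m * (n C 2)) ≡ n * (cliqueDen v m + m * suc v)
  twice-denominator = begin
    2 * (n * ((suc v + m) C 2) + m * (n C 2))      ≡⟨ rearrange₁ n m ((suc v + m) C 2) (n C 2) ⟩
    n * (2 * ((suc v + m) C 2)) + m * (2 * (n C 2))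
      ≡⟨ cong₂ (λ d₁ d₂ → n * d₁ + m * d₂) (2*[1+n]C2≡[1+n]*n (v + m)) (2*[1+n]C2≡[1+n]*n (suc v)) ⟩
    n * cliqueDen v m + m * (n * suc v)            ≡⟨ rearrange₂ n m (cliqueDen v m) (suc v) ⟩
    n * (cliqueDen v m + m * suc v)                ∎
    where
    rearrange₁ : ∀ n m x y → 2 * (n * x + m * y) ≡ n * (2 * x) + m * (2 * y)
    rearrange₁ = solve-∀
    rearrange₂ : ∀ n m e p → n * e + m * (n * p) ≡ n * (e + m * p)
    rearrange₂ = solve-∀

-- The limits

avgClustering-split-→1 : ∀ v → ConvergesTo (λ m → avgClustering (splitGraph (2 + v) m)) 1ℚ
avgClustering-split-→1 v =
  convergesTo-shift 1 {λ m → avgClustering (splitGraph n m)} {1ℚ}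
    (convergesTo-cong {L = 1ℚ} closed-form (ratio-convergesTo {p} {q} {1} {1} n z<s 0<q decay))
  where
  n = 2 + v
  p q : ℕ → ℕ
  p w = n * cliqueNum v (suc w) + suc w * cliqueDen v (suc w)
  q w = (n + suc w) * cliqueDen v (suc w)
  w≤v+1+w : ∀ w → w ≤ v + suc w
  w≤v+1+w w = ≤-trans (n≤1+n w) (m≤n+m (suc w) v)
  0<v+1+w : ∀ w → 0 < v + suc w
  0<v+1+w w = ≤-trans z<s (m≤n+m (suc w) v)
  closed-form : ∀ w → avgClustering (splitGraph n (1 + w)) ≡ ratio (p w) (q w)
  closed-form w = avgClustering-split v (suc w) (0<v+1+w w)
  0<q : ∀ w → 0 < q w
  0<q w = *-mono-< (0<1+n {suc (v + suc w)}) (cliqueDen-pos {v} {suc w} (0<v+1+w w))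
  cross-identity : ∀ v w →
    ((2 + v) * (suc v * v + 2 * suc v * suc w) + suc w * (suc (v + suc w) * (v + suc w))) * 1
      + (2 + v) * suc w * w
    ≡ 1 * ((2 + v + suc w) * (suc (v + suc w) * (v + suc w))) + 0
  cross-identity = solve-∀
  rearrange : ∀ n m w → w * (n * m * w + 0) ≡ n * (w * (m * w))
  rearrange = solve-∀
  decay : ∀ w → w * ∣ p w * 1 - 1 * q w ∣ ≤ n * (q w * 1)
  decay w = begin
    w * ∣ p w * 1 - 1 * q w ∣
      ≤⟨ *-monoʳ-≤ w (∣-∣-≤ {p w * 1} {1 * q w} {n * suc w * w} {0} (cross-identity v w)) ⟩
    w * (n * suc w * w + 0)   ≡⟨ rearrange n (suc w) w ⟩
    n * (w * (suc w * w))     ≤⟨ *-monoʳ-≤ n (*-mono-≤ (≤-trans (n≤1+n w) (m≤n+m (suc w) n))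
                                                      (*-mono-≤ (s≤s (w≤v+1+w w)) (w≤v+1+w w))) ⟩
    n * q w                   ≡⟨ cong (n *_) (*-identityʳ (q w)) ⟨
    n * (q w * 1)             ∎
    where open ≤-Reasoning

transitivity-split-→0 : ∀ v → ConvergesTo (λ m → transitivity (splitGraph (2 + v) m)) 0ℚ
transitivity-split-→0 v =
  convergesTo-shift 1 {λ m → transitivity (splitGraph (2 + v) m)} {0ℚ}
    (convergesTo-cong {L = 0ℚ} (λ w → transitivity-split v (suc w))
      (ratio-convergesTo {p} {q} {0} {1} (3 * suc v) z<s 0<q decay))
  where
  p q : ℕ → ℕ
  p w = suc v * (v + 3 * suc w)
  q w = cliqueDen v (suc w) + suc w * suc v
  0<q : ∀ w → 0 < q w
  0<q w = ≤-trans (cliqueDen-pos {v} {suc w} (≤-trans z<s (m≤n+m (suc w) v))) (m≤m+n _ _)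
  v+3m≤3[v+m] : ∀ v m → v + 3 * m ≤ 3 * (v + m)
  v+3m≤3[v+m] v m = subst (v + 3 * m ≤_) (rearrange₁ v m) (m≤m+n (v + 3 * m) (2 * v))
    where
    rearrange₁ : ∀ v m → v + 3 * m + 2 * v ≡ 3 * (v + m)
    rearrange₁ = solve-∀
  rearrange₂ : ∀ a w x → w * (a * x) ≡ a * (w * x)
  rearrange₂ = solve-∀
  rearrange₃ : ∀ a s x → a * (s * (3 * x)) ≡ 3 * a * (s * x)
  rearrange₃ = solve-∀
  decay : ∀ w → w * ∣ p w * 1 - 0 * q w ∣ ≤ 3 * suc v * (q w * 1)
  decay w = begin
    w * ∣ p w * 1 - 0 ∣
      ≡⟨ cong (w *_) (trans (∣-∣-identityʳ (p w * 1)) (*-identityʳ (p w))) ⟩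
    w * (suc v * (v + 3 * m))                ≡⟨ rearrange₂ (suc v) w (v + 3 * m) ⟩
    suc v * (w * (v + 3 * m))
      ≤⟨ *-monoʳ-≤ (suc v) (*-mono-≤ (≤-trans (n≤1+n w) (≤-trans (m≤n+m m v) (n≤1+n (v + m))))
                                     (v+3m≤3[v+m] v m)) ⟩
    suc v * (suc (v + m) * (3 * (v + m)))    ≡⟨ rearrange₃ (suc v) (suc (v + m)) (v + m) ⟩
    3 * suc v * cliqueDen v m
      ≤⟨ *-monoʳ-≤ (3 * suc v) (≤-trans (m≤m+n _ (m * suc v)) (≤-reflexive (sym (*-identityʳ (q w))))) ⟩
    3 * suc v * (q w * 1)                    ∎
    where
    open ≤-Reasoning
    m = suc w

affine-decay : ∀ {α β γ} v m → α ≤ γ → β ≤ γ → v * (α * m + β) ≤ γ * cliqueDen v m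
affine-decay {α} {β} {γ} v m α≤γ β≤γ = begin
  v * (α * m + β)              ≤⟨ *-mono-≤ (m≤m+n v m) (+-mono-≤ (*-monoˡ-≤ m α≤γ) β≤γ) ⟩
  (v + m) * (γ * m + γ)        ≤⟨ *-monoʳ-≤ (v + m) (+-mono-≤ (*-monoʳ-≤ γ (m≤n+m m v)) (≤-refl {γ})) ⟩
  (v + m) * (γ * (v + m) + γ)  ≡⟨ rearrange γ (v + m) ⟩
  γ * cliqueDen v m            ∎
  where
  open ≤-Reasoning
  rearrange : ∀ γ x → x * (γ * x + γ) ≡ γ * (suc x * x)
  rearrange = solve-∀

-- avgClusteringLimit k = 1 − k²/(k+1)³ and transitivityLimit k = (3k+1)/((k+1)² + k).
avgClusteringLimit transitivityLimit : ℕ → ℚ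
avgClusteringLimit k = ratio (k * k * k + 2 * k * k + 3 * k + 1) (suc k * suc k * suc k)
transitivityLimit  k = ratio (1 + 3 * k) (suc k * suc k + k)

avgClustering-diagonal-→ : ∀ j →
  ConvergesTo (λ n → avgClustering (splitGraph n (suc j * n))) (avgClusteringLimit (suc j))
avgClustering-diagonal-→ j =
  convergesTo-shift 2 {λ n → avgClustering (splitGraph n (k * n))} {avgClusteringLimit k}
    (convergesTo-cong {L = avgClusteringLimit k} closed-form (ratio-convergesTo {p} {q} {A} {B} 2 z<s 0<q decay))
  where
  k = suc j
  K = suc k
  A = k * k * k + 2 * k * k + 3 * k + 1
  B = K * K * K
  m : ℕ → ℕ
  m v = k * (2 + v)
  p q : ℕ → ℕ
  p v = (2 + v) * cliqueNum v (m v) + m v * cliqueDen v (m v)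
  q v = (2 + v + m v) * cliqueDen v (m v)
  0<v+m : ∀ v → 0 < v + m v
  0<v+m v = ≤-trans z<s (m≤n+m (m v) v)
  closed-form : ∀ v → avgClustering (splitGraph (2 + v) (m v)) ≡ ratio (p v) (q v)
  closed-form v = avgClustering-split v (m v) (0<v+m v)
  0<q : ∀ v → 0 < q v
  0<q v = *-mono-< (0<1+n {suc (v + m v)}) (cliqueDen-pos {v} {m v} (0<v+m v))
  -- p B − A q = n K (2k² − K k (2k − 1) n), where 2k − 1 = k + j.
  cross-identity : ∀ j v → let k = suc j; K = suc k; n = 2 + v; m = k * n; e = suc (v + m) * (v + m) in
    (n * (suc v * v + 2 * suc v * m) + m * e) * (K * K * K) + n * K * ((k + j) * K * m)
      ≡ (k * k * k + 2 * k * k + 3 * k + 1) * ((n + m) * e) + n * K * (2 * k * k)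
  cross-identity = solve-∀
  k+j≤2K : k + j ≤ 2 * K
  k+j≤2K = subst (k + j ≤_) (rearrange₁ j) (m≤m+n (k + j) 3)
    where
    rearrange₁ : ∀ j → suc j + j + 3 ≡ 2 * suc (suc j)
    rearrange₁ = solve-∀
  rearrange₂ : ∀ c a b v → v * (c * a + c * b) ≡ c * (v * (a + b))
  rearrange₂ = solve-∀
  rearrange₃ : ∀ n K e → n * K * (2 * K * K * e) ≡ 2 * (n * e * (K * K * K))
  rearrange₃ = solve-∀
  decay : ∀ v → v * ∣ p v * B - A * q v ∣ ≤ 2 * (q v * B)
  decay v = begin
    v * ∣ p v * B - A * q v ∣
      ≤⟨ *-monoʳ-≤ v (∣-∣-≤ {p v * B} {A * q v} {n * K * ((k + j) * K * m v)} {n * K * (2 * k * k)}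
                            (cross-identity j v)) ⟩
    v * (n * K * ((k + j) * K * m v) + n * K * (2 * k * k))
      ≡⟨ rearrange₂ (n * K) ((k + j) * K * m v) (2 * k * k) v ⟩
    n * K * (v * ((k + j) * K * m v + 2 * k * k))
      ≤⟨ *-monoʳ-≤ (n * K) (affine-decay v (m v) (*-monoˡ-≤ K k+j≤2K)
                                          (*-mono-≤ (*-monoʳ-≤ 2 (n≤1+n k)) (n≤1+n k))) ⟩
    n * K * (2 * K * K * e)   ≡⟨ rearrange₃ n K e ⟩
    2 * (n * e * B)           ≤⟨ *-monoʳ-≤ 2 (*-monoˡ-≤ B (*-monoˡ-≤ e (m≤m+n n (m v)))) ⟩
    2 * (q v * B)             ∎
    where
    open ≤-Reasoning
    n = 2 + v
    e = cliqueDen v (m v)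

transitivity-diagonal-→ : ∀ j →
  ConvergesTo (λ n → transitivity (splitGraph n (suc j * n))) (transitivityLimit (suc j))
transitivity-diagonal-→ j =
  convergesTo-shift 2 {λ n → transitivity (splitGraph n (k * n))} {transitivityLimit k}
    (convergesTo-cong {L = transitivityLimit k} (λ v → transitivity-split v (m v))
      (ratio-convergesTo {p} {q} {A} {B} 3 z<s 0<q decay))
  where
  k = suc j
  K = suc k
  A = 1 + 3 * k
  B = K * K + k
  m : ℕ → ℕ
  m v = k * (2 + v)
  p q : ℕ → ℕ
  p v = suc v * (v + 3 * m v)
  q v = cliqueDen v (m v) + m v * suc v
  0<q : ∀ v → 0 < q v
  0<q v = ≤-trans (cliqueDen-pos {v} {m v} (≤-trans z<s (m≤n+m (m v) v))) (m≤m+n _ _)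
  -- p B − A q = 2k² − k (3k² − 1) n, where 3k² − 1 = 3jK + 2.
  cross-identity : ∀ j v → let k = suc j; K = suc k; n = 2 + v; m = k * n; e = suc (v + m) * (v + m) in
    suc v * (v + 3 * m) * (K * K + k) + k * (3 * j * K + 2) * n ≡ (1 + 3 * k) * (e + m * suc v) + 2 * k * k
  cross-identity = solve-∀
  3jK+2≤3KK : 3 * j * K + 2 ≤ 3 * K * K
  3jK+2≤3KK = subst (3 * j * K + 2 ≤_) (rearrange₁ j) (m≤m+n (3 * j * K + 2) (6 * j + 10))
    where
    rearrange₁ : ∀ j → 3 * j * suc (suc j) + 2 + (6 * j + 10) ≡ 3 * suc (suc j) * suc (suc j)
    rearrange₁ = solve-∀
  rearrange₂ : ∀ a b k n v → v * (k * a * n + b) ≡ v * (a * (k * n) + b)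
  rearrange₂ = solve-∀
  rearrange₃ : ∀ K e → 3 * K * K * e ≡ 3 * (e * (K * K))
  rearrange₃ = solve-∀
  decay : ∀ v → v * ∣ p v * B - A * q v ∣ ≤ 3 * (q v * B)
  decay v = begin
    v * ∣ p v * B - A * q v ∣
      ≤⟨ *-monoʳ-≤ v (∣-∣-≤ {p v * B} {A * q v} {k * (3 * j * K + 2) * (2 + v)} {2 * k * k}
                            (cross-identity j v)) ⟩
    v * (k * (3 * j * K + 2) * (2 + v) + 2 * k * k)
      ≡⟨ rearrange₂ (3 * j * K + 2) (2 * k * k) k (2 + v) v ⟩
    v * ((3 * j * K + 2) * m v + 2 * k * k)
      ≤⟨ affine-decay v (m v) 3jK+2≤3KK (*-mono-≤ (*-mono-≤ (n≤1+n 2) (n≤1+n k)) (n≤1+n k)) ⟩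
    3 * K * K * e             ≡⟨ rearrange₃ K e ⟩
    3 * (e * (K * K))         ≤⟨ *-monoʳ-≤ 3 (*-mono-≤ (m≤m+n e (m v * suc v)) (m≤m+n (K * K) k)) ⟩
    3 * (q v * B)             ∎
    where
    open ≤-Reasoning
    e = cliqueDen v (m v)

avgClusteringLimit-→1 : ConvergesTo avgClusteringLimit 1ℚ
avgClusteringLimit-→1 = ratio-convergesTo {p} {q} {1} {1} 1 z<s (λ k → z<s) decay
  where
  p q : ℕ → ℕ
  p k = k * k * k + 2 * k * k + 3 * k + 1
  q k = suc k * suc k * suc k
  cross-identity : ∀ k → (k * k * k + 2 * k * k + 3 * k + 1) * 1 + k * k ≡ 1 * (suc k * suc k * suc k) + 0
  cross-identity = solve-∀
  rearrange : ∀ k → k * (k * k + 0) ≡ k * k * k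
  rearrange = solve-∀
  decay : ∀ k → k * ∣ p k * 1 - 1 * q k ∣ ≤ 1 * (q k * 1)
  decay k = begin
    k * ∣ p k * 1 - 1 * q k ∣
      ≤⟨ *-monoʳ-≤ k (∣-∣-≤ {p k * 1} {1 * q k} {k * k} {0} (cross-identity k)) ⟩
    k * (k * k + 0)             ≡⟨ rearrange k ⟩
    k * k * k                   ≤⟨ *-mono-≤ (*-mono-≤ (n≤1+n k) (n≤1+n k)) (n≤1+n k) ⟩
    q k                         ≡⟨ trans (*-identityˡ (q k * 1)) (*-identityʳ (q k)) ⟨
    1 * (q k * 1)               ∎
    where open ≤-Reasoning

transitivityLimit-→0 : ConvergesTo transitivityLimit 0ℚ
transitivityLimit-→0 = ratio-convergesTo {p} {q} {0} {1} 3 z<s (λ k → z<s) decay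
  where
  p q : ℕ → ℕ
  p k = 1 + 3 * k
  q k = suc k * suc k + k
  rearrange₁ : ∀ k → 1 + 3 * k + 2 ≡ 3 * suc k
  rearrange₁ = solve-∀
  rearrange₂ : ∀ k → suc k * (3 * suc k) ≡ 3 * (suc k * suc k)
  rearrange₂ = solve-∀
  decay : ∀ k → k * ∣ p k * 1 - 0 * q k ∣ ≤ 3 * (q k * 1)
  decay k = begin
    k * ∣ p k * 1 - 0 ∣     ≡⟨ cong (k *_) (trans (∣-∣-identityʳ (p k * 1)) (*-identityʳ (p k))) ⟩
    k * (1 + 3 * k)
      ≤⟨ *-mono-≤ (n≤1+n k) (subst (1 + 3 * k ≤_) (rearrange₁ k) (m≤m+n (1 + 3 * k) 2)) ⟩
    suc k * (3 * suc k)     ≡⟨ rearrange₂ k ⟩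
    3 * (suc k * suc k)     ≤⟨ *-monoʳ-≤ 3 (≤-trans (m≤m+n _ k) (≤-reflexive (sym (*-identityʳ (q k))))) ⟩
    3 * (q k * 1)           ∎
    where open ≤-Reasoning

mainTheorem20 :
    ((n : ℕ) → 2 ≤ n →
        ConvergesTo (λ m → avgClustering (splitGraph n m)) 1ℚ
      × ConvergesTo (λ m → transitivity (splitGraph n m)) 0ℚ)
    × Σ (ℕ → ℚ) (λ L →
        ((k : ℕ) → 1 ≤ k → ConvergesTo (λ n → avgClustering (splitGraph n (k * n))) (L k))
        × ConvergesTo L 1ℚ)
    × Σ (ℕ → ℚ) (λ L →
        ((k : ℕ) → 1 ≤ k → ConvergesTo (λ n → transitivity (splitGraph n (k * n))) (L k))
        × ConvergesTo L 0ℚ)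
mainTheorem20 =
    (λ { (suc (suc v)) _ → avgClustering-split-→1 v , transitivity-split-→0 v ; (suc zero) (s≤s ()) })
  , (avgClusteringLimit , (λ { (suc j) _ → avgClustering-diagonal-→ j }) , avgClusteringLimit-→1)
  , (transitivityLimit , (λ { (suc j) _ → transitivity-diagonal-→ j }) , transitivityLimit-→0)
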